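{- Let $\mathcal{L}$ be a lattice-oriented signature, let $\mathbf{A}$ be an $\mathcal{L}$-lattice and let $\mathbf{A}_0$ be a relatively complete subalgebra of $\mathbf{A}$. For each $a\in A$ define $\Box_0 a:=\max\{b\in A_0\mid b\le a\}$ and $\Diamond_0 a:=\min\{b\in A_0\mid a\le b\}$. Then $\langle\mathbf{A},\Box_0,\Diamond_0\rangle$ is an m-$\mathcal{L}$-lattice and $\Box_0 A=\Diamond_0 A=A_0$.
   Context: A signature $\mathcal{L}$ is lattice-oriented if its set of binary operation symbols contains distinct symbols $\land$ and $\lor$. An $\mathcal{L}$-lattice is an algebra $\mathbf{A}$ of signature $\mathcal{L}$ such that $\langle A,\land,\lor\rangle$ is a lattice, with order $x\le y$ iff $x\land y=x$. A subalgebra $\mathbf{A}_0$ of $\mathbf{A}$ is relatively complete if for every $a\in A$ the set $\{b\in A_0\mid b\le a\}$ has a maximum and the set $\{b\in A_0\mid a\le b\}$ has a minimum (with respect to the lattice order of $\mathbf{A}$). An m-$\mathcal{L}$-lattice is a structure $\langle\mathbf{A},\Box,\Diamond\rangle$ where $\mathbf{A}$ is an $\mathcal{L}$-lattice and $\Box,\Diamond$ are unary operations on $A$ satisfying $\Box x\land x\approx\Box x$, $\Diamond x\lor x\approx \Diamond x$, $\Box(x\land y)\approx\Box x\land\Box y$, $\Diamond(x\lor y)\approx\Diamond x\lor\Diamond y$, $\Box\Diamond x\approx\Diamond x$, $\Diamond\Box x\approx\Box x$, and, for every $n$-ary symbol $\star\in\mathcal{L}$, $\Box(\star(\Box x_1,\dots,\Box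 x_n))\approx\star(\Box x_1,\dots,\Box x_n)$. -}

module Defs where

open import Level using (Level; _⊔_) renaming (suc to lsuc)
open import Data.Nat using (ℕ)
open import Data.Fin using (Fin; zero; suc)
open import Data.Product using (Σ; _×_; _,_; proj₁; ∃)
open import Function using (_∘_)
open import Relation.Binary.PropositionalEquality using (_≡_; _≢_; subst)
open import Algebra.Lattice.Structures using (IsLattice)

record LOSignature (o : Level) : Set (lsuc o) where
  field
    Op      : Set o
    arity   : Op → ℕ
    meet    : Op
    join    : Op
    meet-binary : arity meet ≡ 2
    join-binary : arity join ≡ 2
    meet≢join   : meet ≢ join

pair : ∀ {a} {A : Set a} → A → A → Fin 2 → A
pair x y zero = x
pair x y (suc _) = y

record Algebra {o} (𝓛 : LOSignature o) (a : Level) : Set (o ⊔ lsuc a) where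
  open LOSignature 𝓛
  field
    Carrier : Set a
    ⟦_⟧     : (f : Op) → (Fin (arity f) → Carrier) → Carrier

  infixr 7 _∧_
  infixr 6 _∨_
  _∧_ : Carrier → Carrier → Carrier
  x ∧ y = ⟦ meet ⟧ (λ i → pair x y (subst Fin meet-binary i))

  _∨_ : Carrier → Carrier → Carrier
  x ∨ y = ⟦ join ⟧ (λ i → pair x y (subst Fin join-binary i))

  _≤_ : Carrier → Carrier → Set a
  x ≤ y = x ∧ y ≡ x

record LLattice {o} (𝓛 : LOSignature o) (a : Level) : Set (o ⊔ lsuc a) where
  field
    algebra   : Algebra 𝓛 a
  open Algebra algebra public
  field
    isLattice : IsLattice _≡_ _∨_ _∧_

module _ {o a} {𝓛 : LOSignature o} (𝐀 : LLattice 𝓛 a) where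
  open LOSignature 𝓛
  open LLattice 𝐀

  IsSubalgebra : ∀ {p} → (Carrier → Set p) → Set (o ⊔ a ⊔ p)
  IsSubalgebra A₀ = ∀ (f : Op) (xs : Fin (arity f) → Carrier) →
                    (∀ i → A₀ (xs i)) → A₀ (⟦ f ⟧ xs)

  IsMaxBelow : ∀ {p} → (Carrier → Set p) → Carrier → Carrier → Set (a ⊔ p)
  IsMaxBelow A₀ x b = A₀ b × b ≤ x × (∀ c → A₀ c → c ≤ x → c ≤ b)

  IsMinAbove : ∀ {p} → (Carrier → Set p) → Carrier → Carrier → Set (a ⊔ p)
  IsMinAbove A₀ x b = A₀ b × x ≤ b × (∀ c → A₀ c → x ≤ c → b ≤ c)

  RelativelyComplete : ∀ {p} → (Carrier → Set p) → Set (a ⊔ p)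
  RelativelyComplete A₀ =
    ∀ x → Σ Carrier (IsMaxBelow A₀ x) × Σ Carrier (IsMinAbove A₀ x)

  □₀ : ∀ {p} {A₀ : Carrier → Set p} → RelativelyComplete A₀ → Carrier → Carrier
  □₀ rc x = proj₁ (proj₁ (rc x))

  ◇₀ : ∀ {p} {A₀ : Carrier → Set p} → RelativelyComplete A₀ → Carrier → Carrier
  ◇₀ rc x = proj₁ (Data.Product.proj₂ (rc x))

  record IsMLLattice (□ ◇ : Carrier → Carrier) : Set (o ⊔ a) where
    field
      □-deflationary : ∀ x → □ x ∧ x ≡ □ x
      ◇-inflationary : ∀ x → ◇ x ∨ x ≡ ◇ x
      □-∧            : ∀ x y → □ (x ∧ y) ≡ □ x ∧ □ y
      ◇-∨            : ∀ x y → ◇ (x ∨ y) ≡ ◇ x ∨ ◇ y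
      □◇             : ∀ x → □ (◇ x) ≡ ◇ x
      ◇□             : ∀ x → ◇ (□ x) ≡ □ x
      □-closed       : ∀ (f : Op) (xs : Fin (arity f) → Carrier) →
                       □ (⟦ f ⟧ (□ ∘ xs)) ≡ ⟦ f ⟧ (□ ∘ xs)

  Image : (Carrier → Carrier) → Carrier → Set a
  Image g y = ∃ λ x → g x ≡ y

  SameSet : ∀ {p q} → (Carrier → Set p) → (Carrier → Set q) → Set (a ⊔ p ⊔ q)
  SameSet P Q = ∀ x → (P x → Q x) × (Q x → P x)

-- In a meet semilattice, the greatest element of a ∧-closed set P below x ∧ y
-- is the meet of the greatest ones below x and below y, and each member of P
-- is the greatest element of P below itself.  So □₀ preserves ∧ and fixes
-- exactly A₀, which yields □₀ A = A₀, □₀ ◇₀ = ◇₀ and, A₀ being a subalgebra,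
-- the □-closure of every operation.  ◇₀ is □₀ read in the dual lattice.
module Submission where

open import Defs
open import Data.Product using (_×_; _,_; proj₁)
open import Data.Fin using (Fin; zero; suc)
open import Function using (_∘_)
open import Relation.Binary.PropositionalEquality using (_≡_; sym; trans; subst)
open import Relation.Binary.Lattice using (MeetSemilattice)
import Relation.Binary.Lattice as Order
open import Algebra.Lattice.Structures using (IsLattice)
import Algebra.Lattice.Properties.Lattice as LatticeProperties
import Relation.Binary.Lattice.Properties.JoinSemilattice as JoinSemilatticeProperties

module GreatestBelow {c ℓ₁ ℓ₂ p} (M : MeetSemilattice c ℓ₁ ℓ₂)
                     (P : MeetSemilattice.Carrier M → Set p) where
  open MeetSemilattice M
    renaming (refl to ≤-refl; trans to ≤-trans; antisym to ≤-antisym)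

  IsGreatestBelow : Carrier → Carrier → Set _
  IsGreatestBelow x b = P b × b ≤ x × (∀ c → P c → c ≤ x → c ≤ b)

  greatestBelow-unique : ∀ {x b b′} →
    IsGreatestBelow x b → IsGreatestBelow x b′ → b ≈ b′
  greatestBelow-unique (Pb , b≤x , b-max) (Pb′ , b′≤x , b′-max) =
    ≤-antisym (b′-max _ Pb b≤x) (b-max _ Pb′ b′≤x)

  greatestBelow-self : ∀ {x} → P x → IsGreatestBelow x x
  greatestBelow-self Px = Px , ≤-refl , λ _ _ c≤x → c≤x

  greatestBelow-∧ : (∀ {u v} → P u → P v → P (u ∧ v)) →
    ∀ {x y b b′} → IsGreatestBelow x b → IsGreatestBelow y b′ →
    IsGreatestBelow (x ∧ y) (b ∧ b′)
  greatestBelow-∧ P-∧ (Pb , b≤x , b-max) (Pb′ , b′≤y , b′-max) =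
      P-∧ Pb Pb′
    , ∧-greatest (≤-trans (x∧y≤x _ _) b≤x) (≤-trans (x∧y≤y _ _) b′≤y)
    , λ c Pc c≤x∧y → ∧-greatest
        (b-max c Pc (≤-trans c≤x∧y (x∧y≤x _ _)))
        (b′-max c Pc (≤-trans c≤x∧y (x∧y≤y _ _)))

module _ {o a} {𝓛 : LOSignature o} (𝐀 : LLattice 𝓛 a) where
  open LLattice 𝐀

  sameSet-image : ∀ {p} (g : Carrier → Carrier) {A₀ : Carrier → Set p} →
    (∀ x → A₀ (g x)) → (∀ {x} → A₀ x → g x ≡ x) →
    SameSet 𝐀 (Image 𝐀 g) A₀
  sameSet-image g g-into g-fixes x =
    (λ { (y , gy≡x) → subst _ gy≡x (g-into y) }) , λ A₀x → x , g-fixes A₀x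

  -- Ordered by x ≡ x ∧ y, the symmetric form of _≤_ (x ∧ y ≡ x); hence the
  -- sym's when translating relative completeness below.
  orderLattice : Order.Lattice a a a
  orderLattice = LatticeProperties.∨-∧-orderTheoreticLattice
    (record { isLattice = isLattice })

  open Order.Lattice orderLattice public using (meetSemilattice; joinSemilattice)

  dualMeetSemilattice : MeetSemilattice a a a
  dualMeetSemilattice = JoinSemilatticeProperties.dualMeetSemilattice joinSemilattice

module _ {o a p} {𝓛 : LOSignature o} (𝐀 : LLattice 𝓛 a)
         (A₀ : LLattice.Carrier 𝐀 → Set p) (sub : IsSubalgebra 𝐀 A₀) where
  open LOSignature 𝓛
  open LLattice 𝐀

  private
    pair-closed : ∀ {x y} → A₀ x → A₀ y → ∀ i → A₀ (pair x y i)
    pair-closed A₀x A₀y zero    = A₀x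
    pair-closed A₀x A₀y (suc _) = A₀y

  subalgebra-∧ : ∀ {x y} → A₀ x → A₀ y → A₀ (x ∧ y)
  subalgebra-∧ A₀x A₀y =
    sub meet _ (pair-closed A₀x A₀y ∘ subst Fin meet-binary)

  subalgebra-∨ : ∀ {x y} → A₀ x → A₀ y → A₀ (x ∨ y)
  subalgebra-∨ A₀x A₀y =
    sub join _ (pair-closed A₀x A₀y ∘ subst Fin join-binary)

module RelativelyCompleteSubalgebra
         {o a p} {𝓛 : LOSignature o} (𝐀 : LLattice 𝓛 a)
         (A₀ : LLattice.Carrier 𝐀 → Set p) (sub : IsSubalgebra 𝐀 A₀)
         (rc : RelativelyComplete 𝐀 A₀) where
  open LLattice 𝐀
  open IsLattice isLattice using (∨-comm)
  open JoinSemilatticeProperties (joinSemilattice 𝐀) using (x≤y⇒x∨y≈y)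
  module ⊓ = GreatestBelow (meetSemilattice 𝐀) A₀
  module ⊔ = GreatestBelow (dualMeetSemilattice 𝐀) A₀

  private
    □ ◇ : Carrier → Carrier
    □ = □₀ 𝐀 rc
    ◇ = ◇₀ 𝐀 rc

  □₀-greatestBelow : ∀ x → ⊓.IsGreatestBelow x (□ x)
  □₀-greatestBelow x =
    let (_ , A₀b , b≤x , b-max) , _ = rc x
    in A₀b , sym b≤x , λ c A₀c c≤x → sym (b-max c A₀c (sym c≤x))

  ◇₀-leastAbove : ∀ x → ⊔.IsGreatestBelow x (◇ x)
  ◇₀-leastAbove x =
    let _ , (_ , A₀b , x≤b , b-min) = rc x
    in A₀b , sym x≤b , λ c A₀c x≤c → sym (b-min c A₀c (sym x≤c))

  □₀-fixes : ∀ {x} → A₀ x → □ x ≡ x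
  □₀-fixes {x} A₀x =
    ⊓.greatestBelow-unique (□₀-greatestBelow x) (⊓.greatestBelow-self A₀x)

  ◇₀-fixes : ∀ {x} → A₀ x → ◇ x ≡ x
  ◇₀-fixes {x} A₀x =
    ⊔.greatestBelow-unique (◇₀-leastAbove x) (⊔.greatestBelow-self A₀x)

  □₀-∧ : ∀ x y → □ (x ∧ y) ≡ □ x ∧ □ y
  □₀-∧ x y = ⊓.greatestBelow-unique (□₀-greatestBelow (x ∧ y))
    (⊓.greatestBelow-∧ (subalgebra-∧ 𝐀 A₀ sub)
      (□₀-greatestBelow x) (□₀-greatestBelow y))

  ◇₀-∨ : ∀ x y → ◇ (x ∨ y) ≡ ◇ x ∨ ◇ y
  ◇₀-∨ x y = ⊔.greatestBelow-unique (◇₀-leastAbove (x ∨ y))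
    (⊔.greatestBelow-∧ (subalgebra-∨ 𝐀 A₀ sub)
      (◇₀-leastAbove x) (◇₀-leastAbove y))

  ◇₀-inflationary : ∀ x → ◇ x ∨ x ≡ ◇ x
  ◇₀-inflationary x =
    let _ , x≤◇x , _ = ◇₀-leastAbove x
    in trans (∨-comm (◇ x) x) (x≤y⇒x∨y≈y x≤◇x)

  □₀-◇₀-isMLLattice : IsMLLattice 𝐀 □ ◇
  □₀-◇₀-isMLLattice = record
    { □-deflationary = λ x → let (_ , _ , □x≤x , _) , _ = rc x in □x≤x
    ; ◇-inflationary = ◇₀-inflationary
    ; □-∧            = □₀-∧
    ; ◇-∨            = ◇₀-∨
    ; □◇             = λ x → □₀-fixes (proj₁ (◇₀-leastAbove x))
    ; ◇□             = λ x → ◇₀-fixes (proj₁ (□₀-greatestBelow x))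
    ; □-closed       = λ f xs →
        □₀-fixes (sub f (□ ∘ xs) (proj₁ ∘ □₀-greatestBelow ∘ xs))
    }

lemma3p3 : ∀ {o a p} (𝓛 : LOSignature o) (𝐀 : LLattice 𝓛 a)
             (A₀ : LLattice.Carrier 𝐀 → Set p) →
             IsSubalgebra 𝐀 A₀ →
             (rc : RelativelyComplete 𝐀 A₀) →
             IsMLLattice 𝐀 (□₀ 𝐀 rc) (◇₀ 𝐀 rc)
             × SameSet 𝐀 (Image 𝐀 (□₀ 𝐀 rc)) A₀
             × SameSet 𝐀 (Image 𝐀 (◇₀ 𝐀 rc)) A₀
lemma3p3 𝓛 𝐀 A₀ sub rc =
    □₀-◇₀-isMLLattice
  , sameSet-image 𝐀 (□₀ 𝐀 rc) (proj₁ ∘ □₀-greatestBelow) □₀-fixes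
  , sameSet-image 𝐀 (◇₀ 𝐀 rc) (proj₁ ∘ ◇₀-leastAbove) ◇₀-fixes
  where open RelativelyCompleteSubalgebra 𝐀 A₀ sub rc
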